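{- Let $k$ be a positive integer and $T$ a standard $k$-tableau of weight $(1^m)$. For $1\le i\le m$ let $\beta_i$ be the number of cells of $T$ filled with $i$, let $i^{\uparrow}$ and $i^{\downarrow}$ be the highest and lowest cells filled with $i$, and let $c^{(i)}$ and $c_{(i)}$ be the highest and lowest addable cells of $T_{\le i}$. Then $$\beta_i+\mathrm{diag}(i^{\uparrow},c^{(i)})+\mathrm{diag}(i^{\downarrow},c_{(i)})$$ equals the number of diagonals of residue $\mathrm{res}(i)$ containing cells of $T_{\le i}$.
   Context: Partitions are drawn in French convention: cell $(i,j)$ lies in the $i$-th row from the bottom and $j$-th column from the left. Hook length of $c=(i,j)\in\lambda$: cells to its right in row $i$ plus cells above it in column $j$ plus one. A $(k+1)$-core is a partition with no cell of hook length $k+1$. The residue of cell $(i,j)$ is $(j-i)\bmod(k+1)$; the diagonal of $(i,j)$ is the set of cells with the same value $j-i$, of residue $(j-i)\bmod(k+1)$. For cells $c_1,c_2$, $\mathrm{diag}(c_1,c_2)$ is the number of diagonals of residue $r$ strictly between the diagonals of $c_1$ and $c_2$, where $r$ is the residue of the lower of the two cells. A standard $k$-tableau of weight $(1^m)$ and shape $\lambda$ (a $(k+1)$-core with $m$ cells of hook length $\le k$) is a filling of $\lambda$ with $1,\dots,m$ such that for each $i$ the cells filled with letters $\le i$ form a $(k+1)$-core $\lambda^{(i)}$, $\lambda^{(i)}/\lambda^{(i-1)}$ is a horizontal strip, and all cells filled with $i$ have the same residue $\mathrm{res}(i)$. $T_{\le i}$ is the set of cells filled with letters $\le i$. An addable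 cell of a partition shape is a cell outside it whose addition gives a partition; the lowest (resp. highest) addable cell is the one in the lowest (resp. highest) row. -}

module Defs where

open import Data.Nat using (ℕ; zero; suc; _+_; _∸_; _≤_; _<_; pred; _≤?_) renaming (_≟_ to _≟ℕ_)
open import Data.Integer using (ℤ; +_; _-_; ∣_∣) renaming (_≟_ to _≟ℤ_; _+_ to _+ℤ_; _≤?_ to _≤ℤ?_)
open import Data.Integer.DivMod using (_%ℕ_)
open import Data.List using (List; []; _∷_; length; concatMap; map; upTo; filter)
open import Data.List.Relation.Unary.All using (All)
open import Data.Nat.ListAction using (sum)
open import Data.Bool.ListAction using (any)
open import Data.Bool using (Bool; true; false; if_then_else_; _∨_)
open import Data.Product using (_×_; _,_; proj₁; proj₂; ∃)
open import Data.Sum using (_⊎_)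
open import Relation.Nullary using (¬_; does)
open import Relation.Binary.PropositionalEquality using (_≡_; _≢_)

-- Cells (i , j): i = row from the bottom, j = column from the left (1-indexed, French).
Cell : Set
Cell = ℕ × ℕ

row : Cell → ℕ
row = proj₁

col : Cell → ℕ
col = proj₂

-- A shape is the list of row lengths, bottom row first.
Shape : Set
Shape = List ℕ

part : Shape → ℕ → ℕ
part []       _             = 0
part (x ∷ xs) zero          = 0
part (x ∷ xs) (suc zero)    = x
part (x ∷ xs) (suc (suc n)) = part xs (suc n)

IsPartition : Shape → Set
IsPartition λs = All (1 ≤_) λs × (∀ i → part λs (suc (suc i)) ≤ part λs (suc i))

_∈ₛ_ : Cell → Shape → Set
(i , j) ∈ₛ λs = 1 ≤ i × 1 ≤ j × j ≤ part λs i

conj : Shape → ℕ → ℕ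
conj λs j = length (filter (j ≤?_) λs)

hook : Shape → Cell → ℕ
hook λs (i , j) = (part λs i ∸ j) + (conj λs j ∸ i) + 1

IsCore : ℕ → Shape → Set
IsCore n λs = ∀ c → c ∈ₛ λs → hook λs c ≢ n

cells : Shape → List Cell
cells λs = concatMap (λ i → map (λ j → (suc i , suc j)) (upTo (part λs (suc i)))) (upTo (length λs))

boundedSize : ℕ → Shape → ℕ
boundedSize k λs = length (filter (λ c → hook λs c ≤? k) (cells λs))

size : Shape → ℕ
size = sum

HStrip : Shape → Shape → Set
HStrip μ λs = ∀ i → 1 ≤ i → (part μ i ≤ part λs i) × (part λs (suc i) ≤ part μ i)

content : Cell → ℤ
content (i , j) = + j - + i

residue : ℕ → Cell → ℕ
residue k c = content c %ℕ suc k

count : ℕ → (ℕ → Bool) → ℕ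
count zero    f = 0
count (suc n) f = (if f n then 1 else 0) + count n f

-- diag(c₁,c₂): number of diagonals of residue r strictly between the diagonals of
-- c₁ and c₂, r = residue of the lower cell (c₁ if row c₁ ≤ row c₂).
diag : ℕ → Cell → Cell → ℕ
diag k c₁ c₂ = count (∣ d₁ - d₂ ∣ ∸ 1) (λ t → does (((lo +ℤ (+ suc t)) %ℕ suc k) ≟ℕ r))
  where
  d₁ = content c₁
  d₂ = content c₂
  lo = if does (d₁ ≤ℤ? d₂) then d₁ else d₂
  r  = if does (row c₁ ≤? row c₂) then residue k c₁ else residue k c₂

hasDiag : Shape → ℤ → Bool
hasDiag λs d = any (λ c → does (content c ≟ℤ d)) (cells λs)

-- number of diagonals of residue r containing cells of λ
-- (all contents lie in [ -length λ , part λ 1 ], which is scanned)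
numDiags : ℕ → ℕ → Shape → ℕ
numDiags k r λs = count (suc (length λs + part λs 1))
  (λ t → let d = + t - + length λs in
         does ((d %ℕ suc k) ≟ℕ r) Data.Bool.∧ hasDiag λs d)

Addable : Shape → Cell → Set
Addable μ (r , j) = 1 ≤ r × j ≡ suc (part μ r) × (r ≡ 1 ⊎ part μ r < part μ (pred r))

IsHighestAddable : Shape → Cell → Set
IsHighestAddable μ c = Addable μ c × (∀ c' → Addable μ c' → row c' ≤ row c)

IsLowestAddable : Shape → Cell → Set
IsLowestAddable μ c = Addable μ c × (∀ c' → Addable μ c' → row c ≤ row c')

-- Standard k-tableau of weight (1^m), as the chain of shapes T_{≤0} = ∅ ⊆ … ⊆ T_{≤m}.
record StdKTableau (k m : ℕ) : Set where
  field
    shape      : ℕ → Shape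
    res        : ℕ → ℕ
    shape-zero : shape 0 ≡ []
    isPart     : ∀ i → i ≤ m → IsPartition (shape i)
    isCore     : ∀ i → i ≤ m → IsCore (suc k) (shape i)
    strip      : ∀ i → 1 ≤ i → i ≤ m → HStrip (shape (pred i)) (shape i)
    nonempty   : ∀ i → 1 ≤ i → i ≤ m → ∃ λ c → c ∈ₛ shape i × ¬ (c ∈ₛ shape (pred i))
    sameRes    : ∀ i → 1 ≤ i → i ≤ m → ∀ c → c ∈ₛ shape i → ¬ (c ∈ₛ shape (pred i)) → residue k c ≡ res i
    weight     : boundedSize k (shape m) ≡ m

  Filled : ℕ → Cell → Set
  Filled i c = c ∈ₛ shape i × ¬ (c ∈ₛ shape (pred i))

  β : ℕ → ℕ
  β i = size (shape i) ∸ size (shape (pred i))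

  IsHighestFilled : ℕ → Cell → Set
  IsHighestFilled i c = Filled i c × (∀ c' → Filled i c' → row c' ≤ row c)

  IsLowestFilled : ℕ → Cell → Set
  IsLowestFilled i c = Filled i c × (∀ c' → Filled i c' → row c ≤ row c')

-- Index diagonals by positions t = content + ℓ, where ℓ is the number of rows of ν = T_{≤i}: the
-- diagonals meeting ν are the positions 0 < t < ℓ + ν₁, while the highest and lowest addable cells
-- sit at positions 0 and ℓ + ν₁. The cells filled with i end the rows that grew by one cell (two
-- would be adjacent, hence of different residues), and their positions lie between the positions
-- u of i↑ and w of i↓. Conversely, reading the (k+1)-core condition on the abacus of ν and of
-- T_{≤i-1}, every position of residue res(i) in [u, w] ends such a row. So β_i counts the positions
-- of residue res(i) in [u, w], the two diag terms count those in (0, u) and (w, ℓ + ν₁), and the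
-- three counts add up to the number of diagonals of residue res(i) meeting ν.

module Submission where

open import Defs
open import Data.Nat
open import Data.Nat.Properties
open import Data.Nat.DivMod using (_%_; m%n<n; m≤n⇒m%n≡m; [m+kn]%n≡m%n; %-distribˡ-+; %-distribˡ-*; m%n%n≡m%n)
open import Data.Nat.Divisibility using (_∣_; m%n≡0⇒n∣m; divides)
open import Data.Nat.ListAction using (sum)
open import Data.Nat.Tactic.RingSolver using (solve-∀)
import Data.Integer as ℤ
open import Data.Integer using (ℤ; -[1+_]; _%ℕ_; ∣_∣) renaming (_≤?_ to _≤ℤ?_; _≟_ to _≟ℤ_)
import Data.Integer.Properties as ℤ
open import Data.Integer.Tactic.RingSolver using () renaming (solve-∀ to solve-∀ℤ)
open import Data.List using (List; []; _∷_; length; map; upTo)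
open import Data.List.Relation.Unary.All using (_∷_)
open import Data.List.Membership.Propositional using (_∈_; lose; find)
open import Data.List.Membership.Propositional.Properties using (∈-concatMap⁺; ∈-concatMap⁻; ∈-map⁺; ∈-map⁻; ∈-upTo⁺; ∈-upTo⁻)
open import Data.List.Relation.Unary.Any.Properties using (any⁺; any⁻)
open import Data.Bool using (Bool; true; false; T; if_then_else_; _∧_; not)
open import Data.Bool.Properties using (∧-zeroʳ; ∧-identityʳ; T-≡; T-∧)
open import Data.Unit using (tt)
open import Data.Empty using (⊥-elim)
open import Data.Product using (∃; _×_; _,_; proj₁; proj₂)
open import Data.Sum using (_⊎_; inj₁; inj₂)
open import Function.Base using (_∘_)
open import Function.Bundles using (Equivalence; mk⇔)
open import Relation.Binary.PropositionalEquality
open import Relation.Binary.Definitions using (tri<; tri≈; tri>)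
open import Relation.Nullary using (Dec; yes; no; does; ¬_)
open import Relation.Nullary.Decidable using (dec-true; dec-false; does-⇔)
open import Algebra.Properties.CommutativeSemigroup +-commutativeSemigroup
  using (interchange; x∙yz≈y∙xz; xy∙z≈xz∙y)

open Equivalence using (to; from)

-- Arithmetic modulo k + 1

%-cong-+ʳ : ∀ a b c n .{{_ : NonZero n}} → a % n ≡ b % n → (a + c) % n ≡ (b + c) % n
%-cong-+ʳ a b c n eq = begin
  (a + c) % n             ≡⟨ %-distribˡ-+ a c n ⟩
  (a % n + c % n) % n     ≡⟨ cong (λ x → (x + c % n) % n) eq ⟩
  (b % n + c % n) % n     ≡⟨ %-distribˡ-+ b c n ⟨
  (b + c) % n             ∎
  where open ≡-Reasoning

m+n*[1+k]≡m+n+n*k : ∀ m n k → m + n * suc k ≡ m + n + n * k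
m+n*[1+k]≡m+n+n*k m n k = trans (cong (m +_) (*-suc n k)) (sym (+-assoc m n (n * k)))

%-cancel-+ʳ : ∀ a b c k → (a + c) % suc k ≡ (b + c) % suc k → a % suc k ≡ b % suc k
%-cancel-+ʳ a b c k eq = begin
  a % suc k                     ≡⟨ [m+kn]%n≡m%n a c (suc k) ⟨
  (a + c * suc k) % suc k       ≡⟨ cong (_% suc k) (m+n*[1+k]≡m+n+n*k a c k) ⟩
  (a + c + c * k) % suc k       ≡⟨ %-cong-+ʳ (a + c) (b + c) (c * k) (suc k) eq ⟩
  (b + c + c * k) % suc k       ≡⟨ cong (_% suc k) (m+n*[1+k]≡m+n+n*k b c k) ⟨
  (b + c * suc k) % suc k       ≡⟨ [m+kn]%n≡m%n b c (suc k) ⟩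
  b % suc k                     ∎
  where open ≡-Reasoning

%-reflect : ∀ a b c d k → a + b ≡ c + d → a % suc k ≡ d % suc k → b % suc k ≡ c % suc k
%-reflect a b c d k eq a≡d = %-cancel-+ʳ b c d k (begin
  (b + d) % suc k   ≡⟨ cong (_% suc k) (+-comm b d) ⟩
  (d + b) % suc k   ≡⟨ %-cong-+ʳ a d b (suc k) a≡d ⟨
  (a + b) % suc k   ≡⟨ cong (_% suc k) eq ⟩
  (c + d) % suc k   ∎)
  where open ≡-Reasoning

%-≡⇒∣∸ : ∀ {a b} k → a ≤ b → a % suc k ≡ b % suc k → suc k ∣ b ∸ a
%-≡⇒∣∸ {a} {b} k a≤b eq = m%n≡0⇒n∣m (b ∸ a) (suc k) (%-cancel-+ʳ (b ∸ a) 0 a k (begin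
  (b ∸ a + a) % suc k   ≡⟨ cong (_% suc k) (m∸n+n≡m a≤b) ⟩
  b % suc k             ≡⟨ eq ⟨
  a % suc k             ∎))
  where open ≡-Reasoning

%-≡⇒≡+* : ∀ {a b} k → a ≤ b → a % suc k ≡ b % suc k → ∃ λ j → b ≡ a + j * suc k
%-≡⇒≡+* {a} {b} k a≤b eq with divides j b∸a≡j*n ← %-≡⇒∣∸ k a≤b eq = j , (begin
  b                  ≡⟨ m+[n∸m]≡n a≤b ⟨
  a + (b ∸ a)        ≡⟨ cong (a +_) b∸a≡j*n ⟩
  a + j * suc k      ∎)
  where open ≡-Reasoning

%-suc-≢ : ∀ a {k} → 1 ≤ k → a % suc k ≢ suc a % suc k
%-suc-≢ a {k} 1≤k eq = 0≢1+n (begin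
  0               ≡⟨ m≤n⇒m%n≡m {n = k} z≤n ⟨
  0 % suc k       ≡⟨ %-cancel-+ʳ 0 1 a k eq ⟩
  1 % suc k       ≡⟨ m≤n⇒m%n≡m 1≤k ⟩
  1               ∎)
  where open ≡-Reasoning

[m*o]%n≡[m%n*o]%n : ∀ m o n .{{_ : NonZero n}} → (m * o) % n ≡ (m % n * o) % n
[m*o]%n≡[m%n*o]%n m o n = begin
  (m * o) % n                  ≡⟨ %-distribˡ-* m o n ⟩
  (m % n * (o % n)) % n        ≡⟨ cong (λ x → (x * (o % n)) % n) (m%n%n≡m%n m n) ⟨
  (m % n % n * (o % n)) % n    ≡⟨ %-distribˡ-* (m % n) o n ⟨
  (m % n * o) % n              ∎
  where open ≡-Reasoning

-[1+m]%ℕ[1+k]≡[1+m]*k%[1+k] : ∀ m k → -[1+ m ] %ℕ suc k ≡ (suc m * k) % suc k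
-[1+m]%ℕ[1+k]≡[1+m]*k%[1+k] m k with suc m % suc k in r≡ | [m*o]%n≡[m%n*o]%n (suc m) k (suc k)
... | zero  | eq = sym eq
... | suc r | eq = sym (begin
  (suc m * k) % suc k                   ≡⟨ eq ⟩
  (suc r * k) % suc k                   ≡⟨ cong (_% suc k) step ⟩
  (k ∸ r + r * suc k) % suc k           ≡⟨ [m+kn]%n≡m%n (k ∸ r) r (suc k) ⟩
  (k ∸ r) % suc k                       ≡⟨ m≤n⇒m%n≡m (m∸n≤m k r) ⟩
  k ∸ r                                 ∎)
  where
  open ≡-Reasoning
  r<k : r < k
  r<k = s≤s⁻¹ (subst (_< suc k) r≡ (m%n<n (suc m) (suc k)))
  identity : ∀ d r → suc r * (d + r) ≡ d + r * suc (d + r)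
  identity = solve-∀
  step : suc r * k ≡ (k ∸ r) + r * suc k
  step = subst (λ z → suc r * z ≡ (k ∸ r) + r * suc z) (m∸n+n≡m (<⇒≤ r<k)) (identity (k ∸ r) r)

[+m-+n]%ℕ[1+k]≡[m+n*k]%[1+k] : ∀ m n k → (ℤ.+ m ℤ.- ℤ.+ n) %ℕ suc k ≡ (m + n * k) % suc k
[+m-+n]%ℕ[1+k]≡[m+n*k]%[1+k] m n k with n ≤? m
... | yes n≤m = begin
  (ℤ.+ m ℤ.- ℤ.+ n) %ℕ suc k     ≡⟨ cong (_%ℕ suc k) (trans (ℤ.m-n≡m⊖n m n) (ℤ.⊖-≥ n≤m)) ⟩
  (m ∸ n) % suc k                 ≡⟨ [m+kn]%n≡m%n (m ∸ n) n (suc k) ⟨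
  (m ∸ n + n * suc k) % suc k     ≡⟨ cong (_% suc k) (m+n*[1+k]≡m+n+n*k (m ∸ n) n k) ⟩
  (m ∸ n + n + n * k) % suc k     ≡⟨ cong (λ x → (x + n * k) % suc k) (m∸n+n≡m n≤m) ⟩
  (m + n * k) % suc k             ∎
  where open ≡-Reasoning
... | no n≰m = begin
  (ℤ.+ m ℤ.- ℤ.+ n) %ℕ suc k     ≡⟨ cong (_%ℕ suc k) (trans (ℤ.m-n≡m⊖n m n) (ℤ.⊖-< m<n)) ⟩
  ℤ.- ℤ.+ (n ∸ m) %ℕ suc k        ≡⟨ cong (λ x → ℤ.- ℤ.+ x %ℕ suc k) n∸m≡1+j ⟩
  -[1+ j ] %ℕ suc k               ≡⟨ -[1+m]%ℕ[1+k]≡[1+m]*k%[1+k] j k ⟩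
  (suc j * k) % suc k             ≡⟨ [m+kn]%n≡m%n (suc j * k) m (suc k) ⟨
  (suc j * k + m * suc k) % suc k ≡⟨ cong (_% suc k) (regroup m j k) ⟩
  (m + (m + suc j) * k) % suc k   ≡⟨ cong (λ x → (m + x * k) % suc k) (trans (cong (m +_) (sym n∸m≡1+j)) (m+[n∸m]≡n (<⇒≤ m<n))) ⟩
  (m + n * k) % suc k             ∎
  where
  open ≡-Reasoning
  m<n : m < n
  m<n = ≰⇒> n≰m
  j : ℕ
  j = n ∸ suc m
  n∸m≡1+j : n ∸ m ≡ suc j
  n∸m≡1+j = +-∸-assoc 1 m<n
  regroup : ∀ m j k → suc j * k + m * suc k ≡ m + (m + suc j) * k
  regroup = solve-∀

-- Counting

does-sound : ∀ {A : Set} (a? : Dec A) → T (does a?) → A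
does-sound (yes a) _ = a

does-complete : ∀ {A : Set} (a? : Dec A) → A → T (does a?)
does-complete (yes _) _ = tt
does-complete (no ¬a) a = ¬a a

indicator : Bool → ℕ
indicator b = if b then 1 else 0

count-cong : ∀ n {f g : ℕ → Bool} → (∀ s → s < n → f s ≡ g s) → count n f ≡ count n g
count-cong zero    f≗g = refl
count-cong (suc n) f≗g = cong₂ (λ b c → indicator b + c) (f≗g n ≤-refl) (count-cong n (λ s s<n → f≗g s (m<n⇒m<1+n s<n)))

count-none : ∀ n {f : ℕ → Bool} → (∀ s → s < n → f s ≡ false) → count n f ≡ 0
count-none zero    f≗false = refl
count-none (suc n) f≗false rewrite f≗false n ≤-refl = count-none n (λ s s<n → f≗false s (m<n⇒m<1+n s<n))

count-suc : ∀ n (f : ℕ → Bool) → count (suc n) f ≡ indicator (f 0) + count n (λ s → f (suc s))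
count-suc zero    f = refl
count-suc (suc n) f = begin
  indicator (f (suc n)) + count (suc n) f                                    ≡⟨ cong (indicator (f (suc n)) +_) (count-suc n f) ⟩
  indicator (f (suc n)) + (indicator (f 0) + count n (λ s → f (suc s)))     ≡⟨ x∙yz≈y∙xz (indicator (f (suc n))) (indicator (f 0)) (count n (λ s → f (suc s))) ⟩
  indicator (f 0) + (indicator (f (suc n)) + count n (λ s → f (suc s)))     ∎
  where open ≡-Reasoning

count-+ : ∀ m n (f : ℕ → Bool) → count (m + n) f ≡ count m f + count n (λ s → f (m + s))
count-+ m zero    f = trans (cong (λ x → count x f) (+-identityʳ m)) (sym (+-identityʳ (count m f)))
count-+ m (suc n) f = begin
  count (m + suc n) f                                                   ≡⟨ cong (λ x → count x f) (+-suc m n) ⟩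
  indicator (f (m + n)) + count (m + n) f                               ≡⟨ cong (indicator (f (m + n)) +_) (count-+ m n f) ⟩
  indicator (f (m + n)) + (count m f + count n (λ s → f (m + s)))       ≡⟨ x∙yz≈y∙xz (indicator (f (m + n))) (count m f) (count n (λ s → f (m + s))) ⟩
  count m f + (indicator (f (m + n)) + count n (λ s → f (m + s)))       ∎
  where open ≡-Reasoning

count-reverse : ∀ n (f : ℕ → Bool) → count n f ≡ count n (λ s → f (n ∸ suc s))
count-reverse zero    f = refl
count-reverse (suc n) f = begin
  count (suc n) f                                               ≡⟨ count-suc n f ⟩
  indicator (f 0) + count n (λ s → f (suc s))                   ≡⟨ cong (indicator (f 0) +_) (count-reverse n (λ s → f (suc s))) ⟩
  indicator (f 0) + count n (λ s → f (suc (n ∸ suc s)))         ≡⟨ cong (indicator (f 0) +_) (count-cong n (λ s s<n → cong f (sym (+-∸-assoc 1 s<n)))) ⟩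
  indicator (f 0) + count n (λ s → f (suc n ∸ suc s))           ≡⟨ cong (λ x → indicator (f x) + count n (λ s → f (suc n ∸ suc s))) (n∸n≡0 n) ⟨
  count (suc n) (λ s → f (suc n ∸ suc s))                       ∎
  where open ≡-Reasoning

Without : (ℕ → Bool) → ℕ → ℕ → Bool
Without g t s = g s ∧ not (s ≡ᵇ t)

T-Without⁺ : ∀ {g t s} → T (g s) → s ≢ t → T (Without g t s)
T-Without⁺ {g} {t} {s} gs s≢t with s ≡ᵇ t in e
... | true  = ⊥-elim (s≢t (≡ᵇ⇒≡ s t (subst T (sym e) tt)))
... | false rewrite ∧-identityʳ (g s) = gs

T-Without⁻ : ∀ {g t s} → T (Without g t s) → T (g s) × s ≢ t
T-Without⁻ {g} {t} {s} w with g s | s ≡ᵇ t in e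
... | true | false = tt , λ s≡t → subst T e (≡⇒≡ᵇ s t s≡t)

count-Without : ∀ n (g : ℕ → Bool) {t} → t < n → T (g t) → count n g ≡ suc (count n (Without g t))
count-Without (suc n) g {t} t<1+n gt with n ≡ᵇ t in e
... | true with refl ← ≡ᵇ⇒≡ n t (subst T (sym e) tt) rewrite T-≡ .to gt =
  cong suc (count-cong n λ s s<n → Without-below s s<n)
  where
  Without-below : ∀ s → s < n → g s ≡ Without g n s
  Without-below s s<n with s ≡ᵇ n in e′
  ... | true  = ⊥-elim (<-irrefl (≡ᵇ⇒≡ s n (subst T (sym e′) tt)) s<n)
  ... | false = sym (∧-identityʳ (g s))
... | false = begin
  indicator (g n) + count n g                                  ≡⟨ cong (indicator (g n) +_) (count-Without n g t<n gt) ⟩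
  indicator (g n) + suc (count n (Without g t))                ≡⟨ +-suc (indicator (g n)) _ ⟩
  suc (indicator (g n) + count n (Without g t))                ≡⟨ cong (λ b → suc (indicator b + count n (Without g t))) (∧-identityʳ (g n)) ⟨
  suc (indicator (g n ∧ true) + count n (Without g t))         ∎
  where
  open ≡-Reasoning
  t<n : t < n
  t<n = ≤∧≢⇒< (s≤s⁻¹ t<1+n) (λ t≡n → subst T e (≡⇒≡ᵇ n t (sym t≡n)))

count-bijection : ∀ m n (f g : ℕ → Bool) (p : ℕ → ℕ) →
  (∀ {x} → x < m → T (f x) → p x < n × T (g (p x))) →
  (∀ {y} → y < n → T (g y) → ∃ λ x → x < m × T (f x) × p x ≡ y) →
  (∀ {x x′} → x < m → x′ < m → T (f x) → T (f x′) → p x ≡ p x′ → x ≡ x′) →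
  count m f ≡ count n g
count-bijection zero n f g p into onto inj = sym (count-none n nothing-hit)
  where
  nothing-hit : ∀ y → y < n → g y ≡ false
  nothing-hit y y<n with g y in gy
  ... | false = refl
  ... | true with () ← onto y<n (subst T (sym gy) tt)
count-bijection (suc m) n f g p into onto inj with f m in fm
... | false = count-bijection m n f g p (into ∘ m<n⇒m<1+n) onto′ (λ x<m x′<m → inj (m<n⇒m<1+n x<m) (m<n⇒m<1+n x′<m))
  where
  onto′ : ∀ {y} → y < n → T (g y) → ∃ λ x → x < m × T (f x) × p x ≡ y
  onto′ y<n gy with x , x<1+m , fx , px≡y ← onto y<n gy =
    x , ≤∧≢⇒< (s≤s⁻¹ x<1+m) (λ { refl → subst T fm fx }) , fx , px≡y
... | true = trans (cong suc (count-bijection m n f (Without g (p m)) p into′ onto′ inj′))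
                   (sym (count-Without n g pm<n gpm))
  where
  fm′ : T (f m)
  fm′ = subst T (sym fm) tt
  pm<n : p m < n
  pm<n = proj₁ (into ≤-refl fm′)
  gpm : T (g (p m))
  gpm = proj₂ (into ≤-refl fm′)
  inj′ : ∀ {x x′} → x < m → x′ < m → T (f x) → T (f x′) → p x ≡ p x′ → x ≡ x′
  inj′ x<m x′<m = inj (m<n⇒m<1+n x<m) (m<n⇒m<1+n x′<m)
  into′ : ∀ {x} → x < m → T (f x) → p x < n × T (Without g (p m) (p x))
  into′ x<m fx with px<n , gpx ← into (m<n⇒m<1+n x<m) fx =
    px<n , T-Without⁺ {g} gpx (λ px≡pm → <-irrefl (inj (m<n⇒m<1+n x<m) ≤-refl fx fm′ px≡pm) x<m)
  onto′ : ∀ {y} → y < n → T (Without g (p m) y) → ∃ λ x → x < m × T (f x) × p x ≡ y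
  onto′ y<n wy with gy , y≢pm ← T-Without⁻ {g} wy with x , x<1+m , fx , px≡y ← onto y<n gy =
    x , ≤∧≢⇒< (s≤s⁻¹ x<1+m) (λ { refl → y≢pm (sym px≡y) }) , fx , px≡y

countFrom : ℕ → ℕ → (ℕ → Bool) → ℕ
countFrom a n f = count n (λ s → f (a + s))

countFrom-+ : ∀ a m n f → countFrom a (m + n) f ≡ countFrom a m f + countFrom (a + m) n f
countFrom-+ a m n f = trans (count-+ m n (λ s → f (a + s))) (cong (countFrom a m f +_) (count-cong n (λ s _ → cong f (sym (+-assoc a m s)))))

countFrom-concat : ∀ {a b c} f → a ≤ b → b ≤ c → countFrom a (b ∸ a) f + countFrom b (c ∸ b) f ≡ countFrom a (c ∸ a) f
countFrom-concat {a} {b} {c} f a≤b b≤c = begin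
  countFrom a (b ∸ a) f + countFrom b (c ∸ b) f               ≡⟨ cong (λ x → countFrom a (b ∸ a) f + countFrom x (c ∸ b) f) (m+[n∸m]≡n a≤b) ⟨
  countFrom a (b ∸ a) f + countFrom (a + (b ∸ a)) (c ∸ b) f   ≡⟨ countFrom-+ a (b ∸ a) (c ∸ b) f ⟨
  countFrom a ((b ∸ a) + (c ∸ b)) f                           ≡⟨ cong (λ n → countFrom a n f) (trans (sym (+-∸-comm (c ∸ b) a≤b)) (cong (_∸ a) (m+[n∸m]≡n b≤c))) ⟩
  countFrom a (c ∸ a) f                                       ∎
  where open ≡-Reasoning

-- Partitions

part-beyond : ∀ σ {x} → length σ < x → part σ x ≡ 0
part-beyond []      _                       = refl
part-beyond (_ ∷ σ) {suc (suc x)} (s≤s len<x) = part-beyond σ len<x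

IsPartition-tail : ∀ {h σ} → IsPartition (h ∷ σ) → IsPartition σ
IsPartition-tail (_ ∷ positive , decreasing) = positive , (λ i → decreasing (suc i))

part-positive : ∀ {σ} → IsPartition σ → ∀ {x} → 1 ≤ x → x ≤ length σ → 1 ≤ part σ x
part-positive {[]}    _             {suc _}       _ ()
part-positive {h ∷ σ} (1≤h ∷ _ , _) {1}           _ _             = 1≤h
part-positive {h ∷ σ} P             {suc (suc x)} _ (s≤s x<len) = part-positive (IsPartition-tail P) (s≤s z≤n) x<len

part-positive⇒≤length : ∀ σ {x} → 1 ≤ part σ x → x ≤ length σ
part-positive⇒≤length σ {x} 1≤part with x ≤? length σ
... | yes x≤len = x≤len
... | no  x≰len with () ← subst (1 ≤_) (part-beyond σ (≰⇒> x≰len)) 1≤part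

part-antitone : ∀ {σ} → IsPartition σ → ∀ {x y} → 1 ≤ x → x ≤ y → part σ y ≤ part σ x
part-antitone {σ} P {x} 1≤x x≤y = go (≤⇒≤′ x≤y)
  where
  go : ∀ {y} → x ≤′ y → part σ y ≤ part σ x
  go ≤′-refl                  = ≤-refl
  go (≤′-step {zero}  x≤′0)   with () ← ≤-trans 1≤x (≤′⇒≤ x≤′0)
  go (≤′-step {suc y} x≤′1+y) = ≤-trans (proj₂ P y) (go x≤′1+y)

conj-∷-≤ : ∀ {h y} σ → y ≤ h → conj (h ∷ σ) y ≡ suc (conj σ y)
conj-∷-≤ {h} {y} σ y≤h with y ≤ᵇ h | ≤⇒≤ᵇ y≤h
... | true | _ = refl

conj-∷-≰ : ∀ {h y} σ → ¬ y ≤ h → conj (h ∷ σ) y ≡ conj σ y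
conj-∷-≰ {h} {y} σ y≰h with y ≤ᵇ h in e
... | true  = ⊥-elim (y≰h (≤ᵇ⇒≤ y h (subst T (sym e) tt)))
... | false = refl

part-tail≤head : ∀ {h σ} → IsPartition (h ∷ σ) → ∀ x → part σ x ≤ h
part-tail≤head {σ = []}    _ _       = z≤n
part-tail≤head {σ = _ ∷ _} _ zero    = z≤n
part-tail≤head             P (suc x) = part-antitone P {1} {suc (suc x)} (s≤s z≤n) (s≤s z≤n)

≤part⇒≤conj : ∀ {σ} → IsPartition σ → ∀ {x y} → 1 ≤ x → 1 ≤ y → y ≤ part σ x → x ≤ conj σ y
≤part⇒≤conj {[]}    P {suc x} {suc y} _ _ ()
≤part⇒≤conj {h ∷ σ} P {x} {y} 1≤x 1≤y y≤part with y ≤? h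
... | no y≰h = ⊥-elim (y≰h (≤-trans y≤part (part≤head x)))
  where
  part≤head : ∀ x → part (h ∷ σ) x ≤ h
  part≤head zero          = z≤n
  part≤head 1             = ≤-refl
  part≤head (suc (suc x)) = part-tail≤head P (suc x)
... | yes y≤h rewrite conj-∷-≤ σ y≤h with x
...   | 1           = s≤s z≤n
...   | suc (suc x) = s≤s (≤part⇒≤conj (IsPartition-tail P) (s≤s z≤n) 1≤y y≤part)

≤conj⇒≤part : ∀ {σ} → IsPartition σ → ∀ {x y} → 1 ≤ x → x ≤ conj σ y → y ≤ part σ x
≤conj⇒≤part {[]}    P {suc x} _ ()
≤conj⇒≤part {h ∷ σ} P {x} {y} 1≤x x≤conj with y ≤? h
... | no y≰h rewrite conj-∷-≰ σ y≰h =
  ⊥-elim (y≰h (≤-trans (≤conj⇒≤part (IsPartition-tail P) 1≤x x≤conj) (part-tail≤head P x)))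
... | yes y≤h rewrite conj-∷-≤ σ y≤h with x
...   | 1           = y≤h
...   | suc (suc x) = ≤conj⇒≤part (IsPartition-tail P) (s≤s z≤n) (s≤s⁻¹ x≤conj)

sumBelow : ℕ → (ℕ → ℕ) → ℕ
sumBelow zero    f = 0
sumBelow (suc n) f = f n + sumBelow n f

sumBelow-suc : ∀ n f → sumBelow (suc n) f ≡ f 0 + sumBelow n (λ s → f (suc s))
sumBelow-suc zero    f = refl
sumBelow-suc (suc n) f = trans (cong (f (suc n) +_) (sumBelow-suc n f)) (x∙yz≈y∙xz (f (suc n)) (f 0) _)

size≡sumBelow-rows : ∀ σ n → length σ ≤ n → size σ ≡ sumBelow n (λ s → part σ (suc s))
size≡sumBelow-rows []      zero    _           = refl
size≡sumBelow-rows []      (suc n) _           = size≡sumBelow-rows [] n z≤n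
size≡sumBelow-rows (h ∷ σ) (suc n) (s≤s len≤n) =
  sym (trans (sumBelow-suc n (λ s → part (h ∷ σ) (suc s))) (cong (h +_) (sym (size≡sumBelow-rows σ n len≤n))))

sumBelow-+-count : ∀ n {f g} {b : ℕ → Bool} → (∀ s → s < n → f s ≡ g s + indicator (b s)) →
                   sumBelow n f ≡ sumBelow n g + count n b
sumBelow-+-count zero    _   = refl
sumBelow-+-count (suc n) {f} {g} {b} f≗g+b =
  trans (cong₂ _+_ (f≗g+b n ≤-refl) (sumBelow-+-count n {f} {g} {b} (λ s s<n → f≗g+b s (m<n⇒m<1+n s<n))))
        (interchange (g n) (indicator (b n)) (sumBelow n g) (count n b))

highestAddable≡ : ∀ {σ c} → IsPartition σ → 1 ≤ length σ → IsHighestAddable σ c → c ≡ (suc (length σ) , 1)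
highestAddable≡ {σ} {R , C} P 1≤len ((1≤R , C≡ , corner) , highest) =
  cong₂ _,_ R≡1+len (trans C≡ (cong suc (trans (cong (part σ) R≡1+len) part-above≡0)))
  where
  part-above≡0 : part σ (suc (length σ)) ≡ 0
  part-above≡0 = part-beyond σ ≤-refl
  top-addable : Addable σ (suc (length σ) , 1)
  top-addable = s≤s z≤n , cong suc (sym part-above≡0) ,
                inj₂ (subst (_< part σ (length σ)) (sym part-above≡0) (part-positive P 1≤len ≤-refl))
  R≤1+len : (R ≡ 1 ⊎ part σ R < part σ (pred R)) → R ≤ suc (length σ)
  R≤1+len (inj₁ refl) = s≤s z≤n
  R≤1+len (inj₂ part<) with pred R ≤? length σ
  ... | yes R-1≤len = subst (_≤ suc (length σ)) (suc-pred R {{>-nonZero 1≤R}}) (s≤s R-1≤len)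
  ... | no  R-1≰len = ⊥-elim (<-irrefl (trans (part-beyond σ (≤-trans (≰⇒> R-1≰len) pred[n]≤n))
                                                              (sym (part-beyond σ (≰⇒> R-1≰len)))) part<)
  R≡1+len : R ≡ suc (length σ)
  R≡1+len = ≤-antisym (R≤1+len corner) (highest _ top-addable)

lowestAddable≡ : ∀ {σ c} → IsLowestAddable σ c → c ≡ (1 , suc (part σ 1))
lowestAddable≡ {σ} {R , C} ((1≤R , C≡ , _) , lowest) = cong₂ _,_ R≡1 (trans C≡ (cong (λ x → suc (part σ x)) R≡1))
  where
  R≡1 : R ≡ 1
  R≡1 = ≤-antisym (lowest (1 , suc (part σ 1)) (s≤s z≤n , refl , inj₁ refl)) 1≤R

-- The abacus of a partition

-- Cell (x , y) lies at position y − x + N. A bead at v is a row whose last cell is at v, a gap at v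
-- a column whose first missing cell is at v.
Bead : Shape → ℕ → ℕ → Set
Bead σ N v = ∃ λ x → 1 ≤ x × part σ x + N ≡ v + x

Gap : Shape → ℕ → ℕ → Set
Gap σ N v = ∃ λ y → 1 ≤ y × y + N ≡ v + suc (conj σ y)

module _ {σ : Shape} (P : IsPartition σ) (N v : ℕ) where

  private
    RowBelow : ℕ → Set
    RowBelow x = part σ x + N ≤ v + x

    Threshold : ℕ → Set
    Threshold x = (x ≡ 0 ⊎ ¬ RowBelow x) × RowBelow (suc x)

    threshold-below : ∀ x → RowBelow (suc x) → ∃ Threshold
    threshold-below zero    below = 0 , inj₁ refl , below
    threshold-below (suc x) below with part σ (suc x) + N ≤? v + suc x
    ... | yes below′ = threshold-below x below′
    ... | no  above  = suc x , inj₂ above , below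

    RowBelow-beyond : RowBelow (suc (N + length σ))
    RowBelow-beyond rewrite part-beyond σ {suc (N + length σ)} (s≤s (m≤n+m (length σ) N)) =
      ≤-trans (m≤m+n N (length σ)) (≤-trans (n≤1+n _) (m≤n+m _ v))

    conj-at-threshold : ∀ x → (x ≡ 0 ⊎ ¬ RowBelow x) → ∀ y → 1 ≤ y → y + N ≡ suc (v + x) → x ≤ conj σ y
    conj-at-threshold zero    _            _ _   _         = z≤n
    conj-at-threshold (suc x) (inj₂ above) y 1≤y y+N≡1+v+x = ≤part⇒≤conj P (s≤s z≤n) 1≤y
      (+-cancelʳ-≤ N y (part σ (suc x)) (subst (_≤ part σ (suc x) + N) (sym y+N≡1+v+x) (≰⇒> above)))

  bead⊎gap : Bead σ N v ⊎ Gap σ N v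
  bead⊎gap with x , at , below ← threshold-below (N + length σ) RowBelow-beyond
             with m≤n⇒m<n∨m≡n below
  ... | inj₂ on-bead = inj₁ (suc x , s≤s z≤n , on-bead)
  ... | inj₁ strictly-below = inj₂ (y , 1≤y , y+N≡v+1+conj)
    where
    N≤v+1+x : N ≤ v + suc x
    N≤v+1+x = ≤-trans (m≤n+m N (part σ (suc x))) (<⇒≤ strictly-below)
    y : ℕ
    y = v + suc x ∸ N
    y+N≡ : y + N ≡ v + suc x
    y+N≡ = m∸n+n≡m N≤v+1+x
    part<y : part σ (suc x) < y
    part<y = +-cancelʳ-< N (part σ (suc x)) y (subst (part σ (suc x) + N <_) (sym y+N≡) strictly-below)
    1≤y : 1 ≤ y
    1≤y = ≤-trans (s≤s z≤n) part<y
    conj≤x : conj σ y ≤ x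
    conj≤x with conj σ y ≤? x
    ... | yes conj≤x = conj≤x
    ... | no  conj≰x = ⊥-elim (<⇒≱ part<y (≤conj⇒≤part P (s≤s z≤n) (≰⇒> conj≰x)))
    y+N≡v+1+conj : y + N ≡ v + suc (conj σ y)
    y+N≡v+1+conj = trans y+N≡ (cong (λ z → v + suc z)
      (≤-antisym (conj-at-threshold x at y 1≤y (trans y+N≡ (+-suc v x))) conj≤x))

bead-gap⇒hook : ∀ {σ} → IsPartition σ → ∀ {N v h} ((x , _) : Bead σ N v) ((y , _) : Gap σ N h) → h < v →
                (x , y) ∈ₛ σ × hook σ (x , y) + h ≡ v
bead-gap⇒hook {σ} P {N} {v} {h} (x , 1≤x , bead) (y , 1≤y , gap) h<v = (1≤x , 1≤y , y≤part) , hook+h≡v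
  where
  y≤part : y ≤ part σ x
  y≤part with y ≤? part σ x
  ... | yes y≤part = y≤part
  ... | no  y≰part = ⊥-elim (<⇒≱ (≰⇒> y≰part) (<⇒≤ (+-cancelʳ-< N y (part σ x) y+N<part+N)))
    where
    conj<x : conj σ y < x
    conj<x with suc (conj σ y) ≤? x
    ... | yes conj<x = conj<x
    ... | no  conj≮x = ⊥-elim (y≰part (≤conj⇒≤part P 1≤x (s≤s⁻¹ (≰⇒> conj≮x))))
    y+N<part+N : y + N < part σ x + N
    y+N<part+N = begin-strict
      y + N                 ≡⟨ gap ⟩
      h + suc (conj σ y)    ≤⟨ +-monoʳ-≤ h conj<x ⟩
      h + x                 <⟨ +-monoˡ-< x h<v ⟩
      v + x                 ≡⟨ bead ⟨
      part σ x + N          ∎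
      where open ≤-Reasoning
  arm leg : ℕ
  arm = part σ x ∸ y
  leg = conj σ y ∸ x
  regroup : ∀ arm leg h x → arm + (h + suc (leg + x)) ≡ (arm + leg + 1 + h) + x
  regroup = solve-∀
  hook+h≡v : arm + leg + 1 + h ≡ v
  hook+h≡v = +-cancelʳ-≡ x _ v (begin
    arm + leg + 1 + h + x             ≡⟨ regroup arm leg h x ⟨
    arm + (h + suc (leg + x))         ≡⟨ cong (λ z → arm + (h + suc z)) (m∸n+n≡m (≤part⇒≤conj P 1≤x 1≤y y≤part)) ⟩
    arm + (h + suc (conj σ y))        ≡⟨ cong (arm +_) gap ⟨
    arm + (y + N)                     ≡⟨ +-assoc arm y N ⟨
    arm + y + N                       ≡⟨ cong (_+ N) (m∸n+n≡m y≤part) ⟩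
    part σ x + N                      ≡⟨ bead ⟩
    v + x                             ∎)
    where open ≡-Reasoning

module _ {k σ} (P : IsPartition σ) (core : IsCore (suc k) σ) (N : ℕ) where

  bead-descends : ∀ v → Bead σ N (v + suc k) → Bead σ N v
  bead-descends v bead with bead⊎gap P N v
  ... | inj₁ bead′ = bead′
  ... | inj₂ gap with inσ , hook+v≡v+1+k ← bead-gap⇒hook P bead gap (m<m+n v (s≤s z≤n)) =
    ⊥-elim (core _ inσ (+-cancelʳ-≡ v _ _ (trans hook+v≡v+1+k (+-comm v (suc k)))))

  bead-descends* : ∀ v j → Bead σ N (v + j * suc k) → Bead σ N v
  bead-descends* v zero    bead = subst (Bead σ N) (+-identityʳ v) bead
  bead-descends* v (suc j) bead =
    bead-descends* v j (bead-descends (v + j * suc k) (subst (Bead σ N) (regroup v j (suc k)) bead))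
    where
    regroup : ∀ v j n → v + (n + j * n) ≡ v + j * n + n
    regroup = solve-∀

-- Diagonals as positions

HasPosition : ℕ → Cell → ℕ → Set
HasPosition N (x , y) t = y + N ≡ t + x

-- The residue of the diagonal t − N, using t − N ≡ t + N * k (mod k + 1).
positionResidue : ℕ → ℕ → ℕ → ℕ
positionResidue k N t = (t + N * k) % suc k

content-position : ∀ {N c t} → HasPosition N c t → content c ≡ ℤ.+ t ℤ.- ℤ.+ N
content-position {N} {x , y} {t} y+N≡t+x = begin
  ℤ.+ y ℤ.- ℤ.+ x                                   ≡⟨ shift (ℤ.+ y) (ℤ.+ x) (ℤ.+ N) ⟩
  (ℤ.+ y ℤ.+ ℤ.+ N) ℤ.- (ℤ.+ x ℤ.+ ℤ.+ N)          ≡⟨ cong (ℤ._- (ℤ.+ x ℤ.+ ℤ.+ N)) lifted ⟩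
  (ℤ.+ t ℤ.+ ℤ.+ x) ℤ.- (ℤ.+ x ℤ.+ ℤ.+ N)          ≡⟨ cancel (ℤ.+ t) (ℤ.+ x) (ℤ.+ N) ⟩
  ℤ.+ t ℤ.- ℤ.+ N                                   ∎
  where
  open ≡-Reasoning
  shift : ∀ a b c → a ℤ.- b ≡ (a ℤ.+ c) ℤ.- (b ℤ.+ c)
  shift = solve-∀ℤ
  cancel : ∀ a b c → (a ℤ.+ b) ℤ.- (b ℤ.+ c) ≡ a ℤ.- c
  cancel = solve-∀ℤ
  lifted : ℤ.+ y ℤ.+ ℤ.+ N ≡ ℤ.+ t ℤ.+ ℤ.+ x
  lifted = trans (sym (ℤ.pos-+ y N)) (trans (cong ℤ.+_ y+N≡t+x) (ℤ.pos-+ t x))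

content-position⁻ : ∀ {N c t} → content c ≡ ℤ.+ t ℤ.- ℤ.+ N → HasPosition N c t
content-position⁻ {N} {x , y} {t} eq = ℤ.+-injective (begin
  ℤ.+ (y + N)                                    ≡⟨ ℤ.pos-+ y N ⟩
  ℤ.+ y ℤ.+ ℤ.+ N                                ≡⟨ shift (ℤ.+ y) (ℤ.+ x) (ℤ.+ N) ⟩
  (ℤ.+ y ℤ.- ℤ.+ x) ℤ.+ (ℤ.+ x ℤ.+ ℤ.+ N)       ≡⟨ cong (ℤ._+ (ℤ.+ x ℤ.+ ℤ.+ N)) eq ⟩
  (ℤ.+ t ℤ.- ℤ.+ N) ℤ.+ (ℤ.+ x ℤ.+ ℤ.+ N)       ≡⟨ shift′ (ℤ.+ t) (ℤ.+ N) (ℤ.+ x) ⟨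
  ℤ.+ t ℤ.+ ℤ.+ x                                ≡⟨ ℤ.pos-+ t x ⟨
  ℤ.+ (t + x)                                    ∎)
  where
  open ≡-Reasoning
  shift : ∀ a b c → a ℤ.+ c ≡ (a ℤ.- b) ℤ.+ (b ℤ.+ c)
  shift = solve-∀ℤ
  shift′ : ∀ a b c → a ℤ.+ c ≡ (a ℤ.- b) ℤ.+ (c ℤ.+ b)
  shift′ = solve-∀ℤ

residue-position : ∀ k {N} c {t} → HasPosition N c t → residue k c ≡ positionResidue k N t
residue-position k {N} c {t} pos =
  trans (cong (_%ℕ suc k) (content-position {c = c} pos)) ([+m-+n]%ℕ[1+k]≡[m+n*k]%[1+k] t N k)

lowerResidue : ℕ → Cell → Cell → ℕ
lowerResidue k c₁ c₂ = if does (row c₁ ≤? row c₂) then residue k c₁ else residue k c₂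

diagonalsBetween : ℕ → ℤ → ℤ → ℕ → ℕ
diagonalsBetween k d₁ d₂ r =
  count (∣ d₁ ℤ.- d₂ ∣ ∸ 1) (λ s → does ((((if does (d₁ ≤ℤ? d₂) then d₁ else d₂) ℤ.+ ℤ.+ suc s) %ℕ suc k) ≟ r))

diag≡diagonalsBetween : ∀ k c₁ c₂ → diag k c₁ c₂ ≡ diagonalsBetween k (content c₁) (content c₂) (lowerResidue k c₁ c₂)
diag≡diagonalsBetween k c₁ c₂ = refl

private
  position-distance : ∀ {t t′} N → t ≤ t′ → ∣ (ℤ.+ t′ ℤ.- ℤ.+ N) ℤ.- (ℤ.+ t ℤ.- ℤ.+ N) ∣ ≡ t′ ∸ t
  position-distance {t} {t′} N t≤t′ =
    cong ∣_∣ (trans (cancel (ℤ.+ t′) (ℤ.+ t) (ℤ.+ N)) (trans (ℤ.m-n≡m⊖n t′ t) (ℤ.⊖-≥ t≤t′)))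
    where
    cancel : ∀ a b n → (a ℤ.- n) ℤ.- (b ℤ.- n) ≡ a ℤ.- b
    cancel = solve-∀ℤ

  position-≤ : ∀ {t t′} N → t ≤ t′ → (ℤ.+ t ℤ.- ℤ.+ N) ℤ.≤ (ℤ.+ t′ ℤ.- ℤ.+ N)
  position-≤ N t≤t′ = ℤ.+-monoˡ-≤ (ℤ.- ℤ.+ N) (ℤ.+≤+ t≤t′)

  position-≤⁻ : ∀ {t t′} N → (ℤ.+ t ℤ.- ℤ.+ N) ℤ.≤ (ℤ.+ t′ ℤ.- ℤ.+ N) → t ≤ t′
  position-≤⁻ {t} {t′} N t≤t′ =
    ℤ.drop‿+≤+ (subst₂ ℤ._≤_ (cancel (ℤ.+ t) (ℤ.+ N)) (cancel (ℤ.+ t′) (ℤ.+ N)) (ℤ.+-monoˡ-≤ (ℤ.+ N) t≤t′))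
    where
    cancel : ∀ a n → a ℤ.- n ℤ.+ n ≡ a
    cancel = solve-∀ℤ

  position-residue-after : ∀ k t N s → (((ℤ.+ t ℤ.- ℤ.+ N) ℤ.+ ℤ.+ suc s) %ℕ suc k) ≡ positionResidue k N (t + suc s)
  position-residue-after k t N s = begin
    ((ℤ.+ t ℤ.- ℤ.+ N) ℤ.+ ℤ.+ suc s) %ℕ suc k      ≡⟨ cong (_%ℕ suc k) (swap (ℤ.+ t) (ℤ.+ N) (ℤ.+ suc s)) ⟩
    ((ℤ.+ t ℤ.+ ℤ.+ suc s) ℤ.- ℤ.+ N) %ℕ suc k      ≡⟨ cong (λ a → (a ℤ.- ℤ.+ N) %ℕ suc k) (ℤ.pos-+ t (suc s)) ⟨
    (ℤ.+ (t + suc s) ℤ.- ℤ.+ N) %ℕ suc k            ≡⟨ [+m-+n]%ℕ[1+k]≡[m+n*k]%[1+k] (t + suc s) N k ⟩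
    positionResidue k N (t + suc s)                  ∎
    where
    open ≡-Reasoning
    swap : ∀ a n b → (a ℤ.- n) ℤ.+ b ≡ (a ℤ.+ b) ℤ.- n
    swap = solve-∀ℤ

  count-after≡countFrom : ∀ k N r t n →
    count n (λ s → does ((((ℤ.+ t ℤ.- ℤ.+ N) ℤ.+ ℤ.+ suc s) %ℕ suc k) ≟ r))
      ≡ countFrom (suc t) n (λ t → does (positionResidue k N t ≟ r))
  count-after≡countFrom k N r t n = count-cong n λ s _ →
    cong (λ ρ → does (ρ ≟ r)) (trans (position-residue-after k t N s) (cong (positionResidue k N) (+-suc t s)))

  m∸n∸1≡m∸[1+n] : ∀ m n → m ∸ n ∸ 1 ≡ m ∸ suc n
  m∸n∸1≡m∸[1+n] m n = trans (∸-+-assoc m n 1) (cong (m ∸_) (+-comm n 1))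

diagonalsBetween-< : ∀ k {t t′} N r → t < t′ →
  diagonalsBetween k (ℤ.+ t ℤ.- ℤ.+ N) (ℤ.+ t′ ℤ.- ℤ.+ N) r ≡ countFrom (suc t) (t′ ∸ suc t) (λ t → does (positionResidue k N t ≟ r))
diagonalsBetween-< k {t} {t′} N r t<t′ with (ℤ.+ t ℤ.- ℤ.+ N) ≤ℤ? (ℤ.+ t′ ℤ.- ℤ.+ N)
... | no t≰t′ = ⊥-elim (t≰t′ (position-≤ N (<⇒≤ t<t′)))
... | yes _ rewrite ℤ.∣i-j∣≡∣j-i∣ (ℤ.+ t ℤ.- ℤ.+ N) (ℤ.+ t′ ℤ.- ℤ.+ N) | position-distance N (<⇒≤ t<t′) | m∸n∸1≡m∸[1+n] t′ t =
  count-after≡countFrom k N r t (t′ ∸ suc t)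

diagonalsBetween-> : ∀ k {t t′} N r → t′ < t →
  diagonalsBetween k (ℤ.+ t ℤ.- ℤ.+ N) (ℤ.+ t′ ℤ.- ℤ.+ N) r ≡ countFrom (suc t′) (t ∸ suc t′) (λ t → does (positionResidue k N t ≟ r))
diagonalsBetween-> k {t} {t′} N r t′<t with (ℤ.+ t ℤ.- ℤ.+ N) ≤ℤ? (ℤ.+ t′ ℤ.- ℤ.+ N)
... | yes t≤t′ = ⊥-elim (<⇒≱ t′<t (position-≤⁻ N t≤t′))
... | no _ rewrite position-distance N (<⇒≤ t′<t) | m∸n∸1≡m∸[1+n] t t′ =
  count-after≡countFrom k N r t′ (t ∸ suc t′)

∈ₛ⇒∈cells : ∀ σ {c} → c ∈ₛ σ → c ∈ cells σ
∈ₛ⇒∈cells σ {suc x , suc y} (_ , _ , 1+y≤part) =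
  ∈-concatMap⁺ row-cells (lose (∈-upTo⁺ (part-positive⇒≤length σ (≤-trans (s≤s z≤n) 1+y≤part)))
                               (∈-map⁺ (λ j → suc x , suc j) (∈-upTo⁺ 1+y≤part)))
  where
  row-cells : ℕ → List Cell
  row-cells i = map (λ j → suc i , suc j) (upTo (part σ (suc i)))

∈cells⇒∈ₛ : ∀ σ {c} → c ∈ cells σ → c ∈ₛ σ
∈cells⇒∈ₛ σ c∈cells
  with i , _ , c∈row ← find (∈-concatMap⁻ (λ i → map (λ j → suc i , suc j) (upTo (part σ (suc i)))) {xs = upTo (length σ)} c∈cells)
  with j , j∈ , refl ← ∈-map⁻ (λ j → suc i , suc j) c∈row
  = s≤s z≤n , s≤s z≤n , ∈-upTo⁻ j∈

hasDiag-true : ∀ σ {c d} → c ∈ₛ σ → content c ≡ d → T (hasDiag σ d)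
hasDiag-true σ {c} {d} c∈σ c-on-d =
  any⁺ (λ c → does (content c ≟ℤ d)) (lose (∈ₛ⇒∈cells σ c∈σ) (does-complete (content c ≟ℤ d) c-on-d))

hasDiag-false : ∀ σ {d} → (∀ c → c ∈ₛ σ → content c ≢ d) → hasDiag σ d ≡ false
hasDiag-false σ {d} off-d with hasDiag σ d in e
... | false = refl
... | true with c , c∈cells , c-on-d ← find (any⁻ (λ c → does (content c ≟ℤ d)) (cells σ) (subst T (sym e) tt)) =
  ⊥-elim (off-d c (∈cells⇒∈ₛ σ c∈cells) (does-sound (content c ≟ℤ d) c-on-d))

module _ {σ : Shape} (P : IsPartition σ) (1≤len : 1 ≤ length σ) where

  private
    len top : ℕ
    len = length σ
    top = len + part σ 1

    position : ℕ → ℤ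
    position t = ℤ.+ t ℤ.- ℤ.+ len

    diagonal-occupied : ∀ t → 1 ≤ t → t < top → T (hasDiag σ (position t))
    diagonal-occupied t 1≤t t<top with len ≤? t
    ... | yes len≤t = hasDiag-true σ (s≤s z≤n , s≤s z≤n , 1+t-len≤part) (content-position {c = 1 , suc (t ∸ len)}
                        (trans (cong suc (m∸n+n≡m len≤t)) (+-comm 1 t)))
      where
      1+t-len≤part : suc (t ∸ len) ≤ part σ 1
      1+t-len≤part = +-cancelˡ-< len (t ∸ len) (part σ 1) (subst (_< top) (sym (m+[n∸m]≡n len≤t)) t<top)
    ... | no  len≰t = hasDiag-true σ (s≤s z≤n , s≤s z≤n , part-positive P (s≤s z≤n) 1+len-t≤len) (content-position {c = suc (len ∸ t) , 1}
                        (trans (cong suc (sym (m+[n∸m]≡n (<⇒≤ (≰⇒> len≰t))))) (sym (+-suc t (len ∸ t)))))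
      where
      1+len-t≤len : suc (len ∸ t) ≤ len
      1+len-t≤len = subst (suc (len ∸ t) ≤_) (m∸n+n≡m (<⇒≤ (≰⇒> len≰t))) (subst (_≤ len ∸ t + t) (+-comm (len ∸ t) 1) (+-monoʳ-≤ (len ∸ t) 1≤t))

    diagonal-0-empty : hasDiag σ (position 0) ≡ false
    diagonal-0-empty = hasDiag-false σ λ { (x , y) (_ , 1≤y , y≤part) on-0 →
      <⇒≱ (+-mono-≤ 1≤y (part-positive⇒≤length σ (≤-trans 1≤y y≤part))) (≤-reflexive (content-position⁻ {c = x , y} on-0)) }

    diagonal-top-empty : hasDiag σ (position top) ≡ false
    diagonal-top-empty = hasDiag-false σ λ { (x , y) (1≤x , _ , y≤part) on-top →
      <⇒≱ (≤-<-trans (≤-trans (+-monoˡ-≤ len (≤-trans y≤part (part-antitone P (s≤s z≤n) 1≤x)))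
                              (≤-reflexive (+-comm (part σ 1) len)))
                     (m<m+n top 1≤x))
          (≤-reflexive (sym (content-position⁻ {c = x , y} on-top))) }

  numDiags≡countFrom : ∀ k r → numDiags k r σ ≡ countFrom 1 (top ∸ 1) (λ t → does (positionResidue k len t ≟ r))
  numDiags≡countFrom k r = begin
    count (suc top) occupied-r                                  ≡⟨ cong (λ b → indicator b + count top occupied-r) (empty-false diagonal-top-empty) ⟩
    count top occupied-r                                        ≡⟨ cong (λ n → count n occupied-r) top≡1+E ⟩
    count (suc E) occupied-r                                    ≡⟨ count-suc E occupied-r ⟩
    indicator (occupied-r 0) + count E (λ s → occupied-r (suc s)) ≡⟨ cong (λ b → indicator b + count E (λ s → occupied-r (suc s))) (empty-false diagonal-0-empty) ⟩
    count E (λ s → occupied-r (suc s))                          ≡⟨ count-cong E inner ⟩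
    countFrom 1 E residue-r                                     ∎
    where
    open ≡-Reasoning
    E : ℕ
    E = top ∸ 1
    top≡1+E : top ≡ suc E
    top≡1+E = trans (sym (m∸n+n≡m {n = 1} (≤-trans 1≤len (m≤m+n len (part σ 1))))) (+-comm E 1)
    residue-r : ℕ → Bool
    residue-r t = does (positionResidue k len t ≟ r)
    occupied-r : ℕ → Bool
    occupied-r t = does (((position t) %ℕ suc k) ≟ r) ∧ hasDiag σ (position t)
    empty-false : ∀ {t} → hasDiag σ (position t) ≡ false → occupied-r t ≡ false
    empty-false {t} empty rewrite empty = ∧-zeroʳ (does (((position t) %ℕ suc k) ≟ r))
    inner : ∀ s → s < E → occupied-r (suc s) ≡ residue-r (suc s)
    inner s s<E rewrite T-≡ .to (diagonal-occupied (suc s) (s≤s z≤n) (subst (suc s <_) (sym top≡1+E) (s≤s s<E)))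
                      | [+m-+n]%ℕ[1+k]≡[m+n*k]%[1+k] (suc s) len k = ∧-identityʳ _

positionResidue-reflect : ∀ k N a b c d → a + b ≡ c + d →
  positionResidue k N a ≡ positionResidue k N d → positionResidue k N b ≡ positionResidue k N c
positionResidue-reflect k N a b c d a+b≡c+d = %-reflect (a + K) (b + K) (c + K) (d + K) k (begin
  (a + K) + (b + K)     ≡⟨ interchange a K b K ⟩
  (a + b) + (K + K)     ≡⟨ cong (_+ (K + K)) a+b≡c+d ⟩
  (c + d) + (K + K)     ≡⟨ interchange c d K K ⟩
  (c + K) + (d + K)     ∎)
  where
  open ≡-Reasoning
  K : ℕ
  K = N * k

countFrom-reflect : ∀ k N w n →
  countFrom (suc w) n (λ t → does (positionResidue k N t ≟ positionResidue k N (w + suc n)))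
    ≡ countFrom (suc w) n (λ t → does (positionResidue k N t ≟ positionResidue k N w))
countFrom-reflect k N w n = trans (count-reverse n _) (count-cong n mirror)
  where
  ρ : ℕ → ℕ
  ρ = positionResidue k N
  mirror : ∀ s → s < n → does (ρ (suc w + (n ∸ suc s)) ≟ ρ (w + suc n)) ≡ does (ρ (suc w + s) ≟ ρ w)
  mirror s s<n = does-⇔ (mk⇔ (positionResidue-reflect k N A B w R sum≡)
                             (positionResidue-reflect k N B A R w (trans (+-comm B A) (trans sum≡ (+-comm w R)))))
                        (ρ A ≟ ρ R) (ρ B ≟ ρ w)
    where
    A B R : ℕ
    A = suc w + (n ∸ suc s)
    B = suc w + s
    R = w + suc n
    regroup : ∀ w d s → suc w + d + (suc w + s) ≡ w + (w + suc (d + suc s))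
    regroup = solve-∀
    sum≡ : A + B ≡ w + R
    sum≡ = trans (regroup w (n ∸ suc s) s) (cong (λ z → w + (w + suc z)) (m∸n+n≡m s<n))

-- One step of a standard k-tableau

module Step {k m} (1≤k : 1 ≤ k) (tableau : StdKTableau k m) {i} (1≤i : 1 ≤ i) (i≤m : i ≤ m) where

  open StdKTableau tableau

  ν μ : Shape
  ν = shape i
  μ = shape (pred i)

  ν-partition : IsPartition ν
  ν-partition = isPart i i≤m

  μ-partition : IsPartition μ
  μ-partition = isPart (pred i) (≤-trans pred[n]≤n i≤m)

  ν-core : IsCore (suc k) ν
  ν-core = isCore i i≤m

  μ-core : IsCore (suc k) μ
  μ-core = isCore (pred i) (≤-trans pred[n]≤n i≤m)

  μ⊆ν : ∀ x → 1 ≤ x → part μ x ≤ part ν x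
  μ⊆ν x 1≤x = proj₁ (strip i 1≤i i≤m x 1≤x)

  residue-row : ∀ x y → residue k (x , y) ≡ (y + x * k) % suc k
  residue-row x y = residue-position k (x , y) refl

  part-grows-≤1 : ∀ x → 1 ≤ x → part ν x ≤ suc (part μ x)
  part-grows-≤1 x 1≤x with part ν x ≤? suc (part μ x)
  ... | yes grows-≤1 = grows-≤1
  ... | no  grows-≥2 = ⊥-elim (%-suc-≢ (suc p + x * k) 1≤k (begin
    (suc p + x * k) % suc k           ≡⟨ residue-row x (suc p) ⟨
    residue k (x , suc p)             ≡⟨ new-cell-residue (suc p) ≤-refl (≤-trans (n≤1+n _) 2+p≤part) ⟩
    res i                             ≡⟨ new-cell-residue (suc (suc p)) (n≤1+n _) 2+p≤part ⟨
    residue k (x , suc (suc p))       ≡⟨ residue-row x (suc (suc p)) ⟩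
    (suc (suc p) + x * k) % suc k     ∎))
    where
    open ≡-Reasoning
    p : ℕ
    p = part μ x
    2+p≤part : suc (suc p) ≤ part ν x
    2+p≤part = ≰⇒> grows-≥2
    new-cell-residue : ∀ y → p < y → y ≤ part ν x → residue k (x , y) ≡ res i
    new-cell-residue y p<y y≤part =
      sameRes i 1≤i i≤m _ (1≤x , ≤-trans (s≤s z≤n) p<y , y≤part) (λ (_ , _ , y≤p) → <⇒≱ p<y y≤p)

  NewRow : ℕ → Set
  NewRow x = part ν x ≡ suc (part μ x)

  part-unchanged : ∀ x → 1 ≤ x → ¬ NewRow x → part ν x ≡ part μ x
  part-unchanged x 1≤x not-new with m≤n⇒m<n∨m≡n (part-grows-≤1 x 1≤x)
  ... | inj₂ new      = ⊥-elim (not-new new)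
  ... | inj₁ part<1+p = ≤-antisym (s≤s⁻¹ part<1+p) (μ⊆ν x 1≤x)

  Filled⇒NewRow : ∀ {x y} → Filled i (x , y) → 1 ≤ x × NewRow x × y ≡ part ν x
  Filled⇒NewRow {x} {y} ((1≤x , 1≤y , y≤part) , ∉μ) = 1≤x , new , y≡part
    where
    p<y : part μ x < y
    p<y with y ≤? part μ x
    ... | yes y≤p = ⊥-elim (∉μ (1≤x , 1≤y , y≤p))
    ... | no  y≰p = ≰⇒> y≰p
    y≡part : y ≡ part ν x
    y≡part = ≤-antisym y≤part (≤-trans (part-grows-≤1 x 1≤x) p<y)
    new : NewRow x
    new = ≤-antisym (part-grows-≤1 x 1≤x) (subst (suc (part μ x) ≤_) y≡part p<y)

  NewRow⇒Filled : ∀ {x} → 1 ≤ x → NewRow x → Filled i (x , part ν x)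
  NewRow⇒Filled {x} 1≤x new =
    (1≤x , subst (1 ≤_) (sym new) (s≤s z≤n) , ≤-refl) , λ (_ , _ , part≤p) → 1+n≰n (subst (_≤ part μ x) new part≤p)

  ℓ : ℕ
  ℓ = length ν

  isNewRow : ℕ → Bool
  isNewRow s = does (part ν (suc s) ≟ suc (part μ (suc s)))

  length-μ≤ℓ : length μ ≤ ℓ
  length-μ≤ℓ with length μ ≤? ℓ
  ... | yes len≤ℓ = len≤ℓ
  ... | no  len≰ℓ = ⊥-elim (<⇒≱ (≤-trans (part-positive μ-partition 1≤len ≤-refl) (μ⊆ν (length μ) 1≤len))
                                 (≤-reflexive (part-beyond ν (≰⇒> len≰ℓ))))
    where
    1≤len : 1 ≤ length μ
    1≤len = ≤-trans (s≤s z≤n) (≰⇒> len≰ℓ)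

  β≡count-isNewRow : β i ≡ count ℓ isNewRow
  β≡count-isNewRow = begin
    sum ν ∸ sum μ                            ≡⟨ cong₂ _∸_ (size≡sumBelow-rows ν ℓ ≤-refl) (size≡sumBelow-rows μ ℓ length-μ≤ℓ) ⟩
    sumBelow ℓ rowν ∸ sumBelow ℓ rowμ        ≡⟨ cong (_∸ sumBelow ℓ rowμ) (sumBelow-+-count ℓ rows-differ) ⟩
    sumBelow ℓ rowμ + count ℓ isNewRow ∸ sumBelow ℓ rowμ   ≡⟨ m+n∸m≡n (sumBelow ℓ rowμ) (count ℓ isNewRow) ⟩
    count ℓ isNewRow                          ∎
    where
    open ≡-Reasoning
    rowν rowμ : ℕ → ℕ
    rowν s = part ν (suc s)
    rowμ s = part μ (suc s)
    rows-differ : ∀ s → s < ℓ → rowν s ≡ rowμ s + indicator (isNewRow s)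
    rows-differ s _ with part ν (suc s) ≟ suc (part μ (suc s)) in e
    ... | yes new     rewrite cong does e = trans new (+-comm 1 (rowμ s))
    ... | no  not-new rewrite cong does e = trans (part-unchanged (suc s) (s≤s z≤n) not-new) (sym (+-identityʳ (rowμ s)))

  RowEndsAt : ℕ → ℕ → Set
  RowEndsAt x t = part ν x + ℓ ≡ t + x

  private
    row-ends-antitone : ∀ {x x′ t t′} → 1 ≤ x → x ≤ x′ → RowEndsAt x t → RowEndsAt x′ t′ → t′ + x′ ≤ t + x
    row-ends-antitone {x} {x′} {t} {t′} 1≤x x≤x′ end end′ = begin
      t′ + x′           ≡⟨ end′ ⟨
      part ν x′ + ℓ     ≤⟨ +-monoˡ-≤ ℓ (part-antitone ν-partition 1≤x x≤x′) ⟩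
      part ν x + ℓ      ≡⟨ end ⟩
      t + x             ∎
      where open ≤-Reasoning

  position-antitone : ∀ {x x′ t t′} → 1 ≤ x → x ≤ x′ → RowEndsAt x t → RowEndsAt x′ t′ → t′ ≤ t
  position-antitone {x} {x′} {t} {t′} 1≤x x≤x′ end end′ =
    +-cancelʳ-≤ x′ t′ t (≤-trans (row-ends-antitone 1≤x x≤x′ end end′) (+-monoʳ-≤ t x≤x′))

  position-strictly-antitone : ∀ {x x′ t t′} → 1 ≤ x → x < x′ → RowEndsAt x t → RowEndsAt x′ t′ → t′ < t
  position-strictly-antitone {x} {x′} {t} {t′} 1≤x x<x′ end end′ =
    +-cancelʳ-< x′ t′ t (≤-<-trans (row-ends-antitone 1≤x (<⇒≤ x<x′) end end′) (+-monoʳ-< t x<x′))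

  NewPosition : ℕ → Set
  NewPosition t = ∃ λ x → 1 ≤ x × NewRow x × RowEndsAt x t

  ρ : ℕ → ℕ
  ρ = positionResidue k ℓ

  r : ℕ
  r = res i

  NewRow⇒residue : ∀ {x t} → 1 ≤ x → NewRow x → RowEndsAt x t → ρ t ≡ r
  NewRow⇒residue {x} 1≤x new end with ∈ν , ∉μ ← NewRow⇒Filled 1≤x new =
    trans (sym (residue-position k (x , part ν x) end)) (sameRes i 1≤i i≤m _ ∈ν ∉μ)

  ρ-≡⇒≡+* : ∀ {t t′} → t ≤ t′ → ρ t ≡ ρ t′ → ∃ λ j → t′ ≡ t + j * suc k
  ρ-≡⇒≡+* {t} {t′} t≤t′ eq with j , shifted ← %-≡⇒≡+* k (+-monoˡ-≤ (ℓ * k) t≤t′) eq =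
    j , +-cancelʳ-≡ (ℓ * k) t′ (t + j * suc k) (trans shifted (xy∙z≈xz∙y t (ℓ * k) (j * suc k)))

  module Extremes (iup idown : Cell) (highest : IsHighestFilled i iup) (lowest : IsLowestFilled i idown) where

    a b : ℕ
    a = row iup
    b = row idown

    1≤a : 1 ≤ a
    1≤a = proj₁ (Filled⇒NewRow (proj₁ highest))
    1≤b : 1 ≤ b
    1≤b = proj₁ (Filled⇒NewRow (proj₁ lowest))
    a-new : NewRow a
    a-new = proj₁ (proj₂ (Filled⇒NewRow (proj₁ highest)))
    b-new : NewRow b
    b-new = proj₁ (proj₂ (Filled⇒NewRow (proj₁ lowest)))

    NewRow⇒≤a : ∀ {x} → 1 ≤ x → NewRow x → x ≤ a
    NewRow⇒≤a 1≤x new = proj₂ highest _ (NewRow⇒Filled 1≤x new)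
    NewRow⇒b≤ : ∀ {x} → 1 ≤ x → NewRow x → b ≤ x
    NewRow⇒b≤ 1≤x new = proj₂ lowest _ (NewRow⇒Filled 1≤x new)

    a≤ℓ : a ≤ ℓ
    a≤ℓ = part-positive⇒≤length ν (subst (1 ≤_) (sym a-new) (s≤s z≤n))
    b≤ℓ : b ≤ ℓ
    b≤ℓ = part-positive⇒≤length ν (subst (1 ≤_) (sym b-new) (s≤s z≤n))

    u w : ℕ
    u = part ν a + ℓ ∸ a
    w = part ν b + ℓ ∸ b

    a-ends-at-u : RowEndsAt a u
    a-ends-at-u = sym (m∸n+n≡m (≤-trans a≤ℓ (m≤n+m ℓ _)))
    b-ends-at-w : RowEndsAt b w
    b-ends-at-w = sym (m∸n+n≡m (≤-trans b≤ℓ (m≤n+m ℓ _)))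

    u≤w : u ≤ w
    u≤w = position-antitone 1≤b (NewRow⇒b≤ 1≤a a-new) b-ends-at-w a-ends-at-u

    1≤u : 1 ≤ u
    1≤u = +-cancelʳ-≤ a 1 u (begin
      1 + a             ≤⟨ +-mono-≤ (subst (1 ≤_) (sym a-new) (s≤s z≤n)) a≤ℓ ⟩
      part ν a + ℓ      ≡⟨ a-ends-at-u ⟩
      u + a             ∎)
      where open ≤-Reasoning

    ρu≡r : ρ u ≡ r
    ρu≡r = NewRow⇒residue 1≤a a-new a-ends-at-u
    ρw≡r : ρ w ≡ r
    ρw≡r = NewRow⇒residue 1≤b b-new b-ends-at-w

    NewPosition⇒window : ∀ {t} → NewPosition t → u ≤ t × t ≤ w × ρ t ≡ r
    NewPosition⇒window (x , 1≤x , new , end) =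
      position-antitone 1≤x (NewRow⇒≤a 1≤x new) end a-ends-at-u ,
      position-antitone 1≤b (NewRow⇒b≤ 1≤x new) b-ends-at-w end ,
      NewRow⇒residue 1≤x new end

    -- Rows of μ at or above a end left of u, rows below a end right of it (ν / μ is a horizontal strip).
    μ-has-no-bead-at-u : ¬ Bead μ ℓ u
    μ-has-no-bead-at-u (x , 1≤x , μ-end) with a ≤? x
    ... | yes a≤x = <-irrefl (begin-equality
      part μ x + ℓ + a              ≡⟨ cong (_+ a) μ-end ⟩
      u + x + a                     ≡⟨ xy∙z≈xz∙y u x a ⟩
      u + a + x                     ≡⟨ cong (_+ x) a-ends-at-u ⟨
      part ν a + ℓ + x              ≡⟨ cong (λ p → p + ℓ + x) a-new ⟩
      suc (part μ a) + ℓ + x        ∎) (begin-strict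
      part μ x + ℓ + a              <⟨ s≤s (+-mono-≤ (+-monoˡ-≤ ℓ (part-antitone μ-partition 1≤a a≤x)) a≤x) ⟩
      suc (part μ a) + ℓ + x        ∎)
      where open ≤-Reasoning
    ... | no  a≰x = <-irrefl refl (begin-strict
      part ν a + ℓ                  ≤⟨ +-monoˡ-≤ ℓ (≤-trans ν-a≤μ-a−1 (part-antitone μ-partition 1≤x x≤a−1)) ⟩
      part μ x + ℓ                  ≡⟨ μ-end ⟩
      u + x                         <⟨ +-monoʳ-< u (≰⇒> a≰x) ⟩
      u + a                         ≡⟨ a-ends-at-u ⟨
      part ν a + ℓ                  ∎)
      where
      open ≤-Reasoning
      x≤a−1 : x ≤ pred a
      x≤a−1 = ≤-pred (≤-trans (≰⇒> a≰x) (≤-reflexive (sym (suc-pred a {{>-nonZero 1≤a}}))))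
      ν-a≤μ-a−1 : part ν a ≤ part μ (pred a)
      ν-a≤μ-a−1 = subst (λ y → part ν y ≤ part μ (pred a)) (suc-pred a {{>-nonZero 1≤a}})
                        (proj₂ (strip i 1≤i i≤m (pred a) (≤-trans 1≤x x≤a−1)))

    -- The core property moves the row of ν ending at t + k + 1 down to one ending at t; were that row
    -- not new, μ would have a bead at t ≡ u (mod k + 1), hence one at u.
    NewPosition-descends : ∀ j → NewPosition (u + j * suc k + suc k) → NewPosition (u + j * suc k)
    NewPosition-descends j (x , 1≤x , _ , end)
      with x′ , 1≤x′ , end′ ← bead-descends ν-partition ν-core ℓ (u + j * suc k) (x , 1≤x , end)
      with part ν x′ ≟ suc (part μ x′)
    ... | yes new     = x′ , 1≤x′ , new , end′
    ... | no  not-new = ⊥-elim (μ-has-no-bead-at-u (bead-descends* μ-partition μ-core ℓ u j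
                          (x′ , 1≤x′ , trans (cong (_+ ℓ) (sym (part-unchanged x′ 1≤x′ not-new))) end′)))

    NewPosition-descends* : ∀ j d → NewPosition (u + (j + d) * suc k) → NewPosition (u + j * suc k)
    NewPosition-descends* j zero    new = subst (λ z → NewPosition (u + z * suc k)) (+-identityʳ j) new
    NewPosition-descends* j (suc d) new = NewPosition-descends j
      (subst NewPosition (regroup u j (suc k)) (NewPosition-descends* (suc j) d (subst (λ z → NewPosition (u + z * suc k)) (+-suc j d) new)))
      where
      regroup : ∀ u j n → u + (n + j * n) ≡ u + j * n + n
      regroup = solve-∀

    window⇒NewPosition : ∀ {t} → u ≤ t → t ≤ w → ρ t ≡ r → NewPosition t
    window⇒NewPosition {t} u≤t t≤w ρt≡r
      with j , t≡ ← ρ-≡⇒≡+* u≤t (trans ρu≡r (sym ρt≡r))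
         | M , w≡ ← ρ-≡⇒≡+* u≤w (trans ρu≡r (sym ρw≡r)) =
      subst NewPosition (sym t≡) (NewPosition-descends* j (M ∸ j)
        (subst (λ z → NewPosition (u + z * suc k)) (sym (m+[n∸m]≡n j≤M)) (subst NewPosition w≡ (b , 1≤b , b-new , b-ends-at-w))))
      where
      j≤M : j ≤ M
      j≤M = *-cancelʳ-≤ j M (suc k) (+-cancelˡ-≤ u (j * suc k) (M * suc k) (subst₂ _≤_ t≡ w≡ t≤w))

    atResidue : ℕ → Bool
    atResidue t = does (ρ t ≟ r)

    private
      inWindow : ℕ → Bool
      inWindow t = does (u ≤? t) ∧ atResidue t

      rowPosition : ℕ → ℕ
      rowPosition s = part ν (suc s) + ℓ ∸ suc s

      row-ends-at-rowPosition : ∀ {s} → s < ℓ → RowEndsAt (suc s) (rowPosition s)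
      row-ends-at-rowPosition s<ℓ = sym (m∸n+n≡m (≤-trans s<ℓ (m≤n+m ℓ _)))

      into : ∀ {s} → s < ℓ → T (isNewRow s) → rowPosition s < suc w × T (inWindow (rowPosition s))
      into {s} s<ℓ new
        with u≤t , t≤w , ρt≡r ← NewPosition⇒window (suc s , s≤s z≤n , does-sound (part ν (suc s) ≟ suc (part μ (suc s))) new , row-ends-at-rowPosition s<ℓ) =
        s≤s t≤w , T-∧ .from (does-complete (u ≤? rowPosition s) u≤t , does-complete (ρ (rowPosition s) ≟ r) ρt≡r)

      onto : ∀ {t} → t < suc w → T (inWindow t) → ∃ λ s → s < ℓ × T (isNewRow s) × rowPosition s ≡ t
      onto {t} t<1+w inside with u≤t , ρt≡r ← T-∧ .to inside
        with suc s , _ , new , end ← window⇒NewPosition (does-sound (u ≤? t) u≤t) (s≤s⁻¹ t<1+w) (does-sound (ρ t ≟ r) ρt≡r) =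
        s , part-positive⇒≤length ν (subst (1 ≤_) (sym new) (s≤s z≤n)) , does-complete (_ ≟ _) new ,
        trans (cong (_∸ suc s) end) (m+n∸n≡m t (suc s))

      rowPosition-injective : ∀ {s s′} → s < ℓ → s′ < ℓ → T (isNewRow s) → T (isNewRow s′) → rowPosition s ≡ rowPosition s′ → s ≡ s′
      rowPosition-injective {s} {s′} s<ℓ s′<ℓ _ _ same with <-cmp s s′
      ... | tri≈ _ s≡s′ _ = s≡s′
      ... | tri< s<s′ _ _ = ⊥-elim (<-irrefl (sym same)
        (position-strictly-antitone (s≤s z≤n) (s≤s s<s′) (row-ends-at-rowPosition s<ℓ) (row-ends-at-rowPosition s′<ℓ)))
      ... | tri> _ _ s′<s = ⊥-elim (<-irrefl same
        (position-strictly-antitone (s≤s z≤n) (s≤s s′<s) (row-ends-at-rowPosition s′<ℓ) (row-ends-at-rowPosition s<ℓ)))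

    β≡count-between : β i ≡ countFrom u (suc w ∸ u) atResidue
    β≡count-between = begin
      β i                                                        ≡⟨ β≡count-isNewRow ⟩
      count ℓ isNewRow                                           ≡⟨ count-bijection ℓ (suc w) isNewRow inWindow rowPosition into onto rowPosition-injective ⟩
      count (suc w) inWindow                                     ≡⟨ cong (λ z → count z inWindow) (m+[n∸m]≡n (m≤n⇒m≤1+n u≤w)) ⟨
      count (u + (suc w ∸ u)) inWindow                           ≡⟨ count-+ u (suc w ∸ u) inWindow ⟩
      count u inWindow + count (suc w ∸ u) (λ s → inWindow (u + s))
                                                                 ≡⟨ cong₂ _+_ (count-none u below-u) (count-cong (suc w ∸ u) above-u) ⟩
      countFrom u (suc w ∸ u) atResidue                      ∎
      where
      open ≡-Reasoning
      below-u : ∀ t → t < u → inWindow t ≡ false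
      below-u t t<u = cong (_∧ atResidue t) (dec-false (u ≤? t) (<⇒≱ t<u))
      above-u : ∀ s → s < suc w ∸ u → inWindow (u + s) ≡ atResidue (u + s)
      above-u s _ = cong (_∧ atResidue (u + s)) (dec-true (u ≤? u + s) (m≤m+n u s))

    1≤ℓ : 1 ≤ ℓ
    1≤ℓ = ≤-trans 1≤a a≤ℓ

    top : ℕ
    top = ℓ + part ν 1

    iup-position : HasPosition ℓ iup u
    iup-position = subst (λ y → y + ℓ ≡ u + a) (sym (proj₂ (proj₂ (Filled⇒NewRow (proj₁ highest))))) a-ends-at-u

    idown-position : HasPosition ℓ idown w
    idown-position = subst (λ y → y + ℓ ≡ w + b) (sym (proj₂ (proj₂ (Filled⇒NewRow (proj₁ lowest))))) b-ends-at-w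

    w<top : w < top
    w<top = +-cancelʳ-< b w top (begin-strict
      w + b                ≡⟨ b-ends-at-w ⟨
      part ν b + ℓ         ≤⟨ +-monoˡ-≤ ℓ (part-antitone ν-partition (s≤s z≤n) 1≤b) ⟩
      part ν 1 + ℓ         ≡⟨ +-comm (part ν 1) ℓ ⟩
      top                  <⟨ m<m+n top 1≤b ⟩
      top + b              ∎)
      where open ≤-Reasoning

    diag-up : ∀ {cup} → IsHighestAddable ν cup → diag k iup cup ≡ countFrom 1 (u ∸ 1) atResidue
    diag-up highest-addable rewrite highestAddable≡ ν-partition 1≤ℓ highest-addable = begin
      diag k iup (suc ℓ , 1)
        ≡⟨ diag≡diagonalsBetween k iup (suc ℓ , 1) ⟩
      diagonalsBetween k (content iup) (content (suc ℓ , 1)) (lowerResidue k iup (suc ℓ , 1))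
        ≡⟨ cong₂ (λ d → diagonalsBetween k d (content (suc ℓ , 1))) (content-position {c = iup} iup-position) lower≡r ⟩
      diagonalsBetween k (ℤ.+ u ℤ.- ℤ.+ ℓ) (content (suc ℓ , 1)) r
        ≡⟨ cong (λ d → diagonalsBetween k (ℤ.+ u ℤ.- ℤ.+ ℓ) d r) (content-position {N = ℓ} {c = suc ℓ , 1} {t = 0} refl) ⟩
      diagonalsBetween k (ℤ.+ u ℤ.- ℤ.+ ℓ) (ℤ.+ 0 ℤ.- ℤ.+ ℓ) r
        ≡⟨ diagonalsBetween-> k ℓ r 1≤u ⟩
      countFrom 1 (u ∸ 1) atResidue ∎
      where
      open ≡-Reasoning
      lower≡r : lowerResidue k iup (suc ℓ , 1) ≡ r
      lower≡r rewrite dec-true (a ≤? suc ℓ) (m≤n⇒m≤1+n a≤ℓ) = sameRes i 1≤i i≤m iup (proj₁ (proj₁ highest)) (proj₂ (proj₁ highest))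

    diag-down : ∀ {cdown} → IsLowestAddable ν cdown → diag k idown cdown ≡ countFrom (suc w) (top ∸ suc w) atResidue
    diag-down lowest-addable rewrite lowestAddable≡ {ν} lowest-addable = begin
      diag k idown cdown
        ≡⟨ diag≡diagonalsBetween k idown cdown ⟩
      diagonalsBetween k (content idown) (content cdown) (lowerResidue k idown cdown)
        ≡⟨ cong₂ (λ d → diagonalsBetween k d (content cdown)) (content-position {c = idown} idown-position) refl ⟩
      diagonalsBetween k (ℤ.+ w ℤ.- ℤ.+ ℓ) (content cdown) (lowerResidue k idown cdown)
        ≡⟨ cong (λ d → diagonalsBetween k (ℤ.+ w ℤ.- ℤ.+ ℓ) d (lowerResidue k idown cdown)) (content-position {c = cdown} cdown-position) ⟩
      diagonalsBetween k (ℤ.+ w ℤ.- ℤ.+ ℓ) (ℤ.+ top ℤ.- ℤ.+ ℓ) (lowerResidue k idown cdown)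
        ≡⟨ diagonalsBetween-< k ℓ (lowerResidue k idown cdown) w<top ⟩
      countFrom (suc w) (top ∸ suc w) (λ t → does (ρ t ≟ lowerResidue k idown cdown))
        ≡⟨ lower-residue-irrelevant ⟩
      countFrom (suc w) (top ∸ suc w) atResidue ∎
      where
      open ≡-Reasoning
      cdown : Cell
      cdown = 1 , suc (part ν 1)
      cdown-position : HasPosition ℓ cdown top
      cdown-position = trans (cong suc (+-comm (part ν 1) ℓ)) (+-comm 1 top)
      top≡ : top ≡ w + suc (top ∸ suc w)
      top≡ = sym (trans (+-suc w (top ∸ suc w)) (m+[n∸m]≡n w<top))
      lower-residue-irrelevant : countFrom (suc w) (top ∸ suc w) (λ t → does (ρ t ≟ lowerResidue k idown cdown))
                                   ≡ countFrom (suc w) (top ∸ suc w) atResidue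
      lower-residue-irrelevant with b ≤ᵇ 1
      ... | true  rewrite sameRes i 1≤i i≤m idown (proj₁ (proj₁ lowest)) (proj₂ (proj₁ lowest)) = refl
      -- i↓ is above the bottom row, so diag uses the residue of the lowest addable cell; reflecting the
      -- interval (w, top) exchanges the residues of its endpoints.
      ... | false = begin
        countFrom (suc w) n (hasResidue (residue k cdown))   ≡⟨ cong (countFrom (suc w) n ∘ hasResidue) (trans (residue-position k cdown cdown-position) (cong ρ top≡)) ⟩
        countFrom (suc w) n (hasResidue (ρ (w + suc n)))     ≡⟨ countFrom-reflect k ℓ w n ⟩
        countFrom (suc w) n (hasResidue (ρ w))               ≡⟨ cong (countFrom (suc w) n ∘ hasResidue) ρw≡r ⟩
        countFrom (suc w) n atResidue                             ∎
        where
        n : ℕ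
        n = top ∸ suc w
        hasResidue : ℕ → ℕ → Bool
        hasResidue R t = does (ρ t ≟ R)

lemma6p8 : (k m : ℕ) → 1 ≤ k → (T : StdKTableau k m) → (i : ℕ) → 1 ≤ i → i ≤ m →
    (iup idown cup cdown : Cell) →
    StdKTableau.IsHighestFilled T i iup → StdKTableau.IsLowestFilled T i idown →
    IsHighestAddable (StdKTableau.shape T i) cup → IsLowestAddable (StdKTableau.shape T i) cdown →
    StdKTableau.β T i + diag k iup cup + diag k idown cdown
      ≡ numDiags k (StdKTableau.res T i) (StdKTableau.shape T i)
lemma6p8 k m 1≤k tableau i 1≤i i≤m iup idown cup cdown highest lowest highest-addable lowest-addable = begin
  β i + diag k iup cup + diag k idown cdown
    ≡⟨ cong₂ _+_ (cong₂ _+_ β≡count-between (diag-up highest-addable)) (diag-down lowest-addable) ⟩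
  countFrom u (suc w ∸ u) atResidue + countFrom 1 (u ∸ 1) atResidue + countFrom (suc w) (top ∸ suc w) atResidue
    ≡⟨ cong (_+ countFrom (suc w) (top ∸ suc w) atResidue) (+-comm (countFrom u (suc w ∸ u) atResidue) (countFrom 1 (u ∸ 1) atResidue)) ⟩
  countFrom 1 (u ∸ 1) atResidue + countFrom u (suc w ∸ u) atResidue + countFrom (suc w) (top ∸ suc w) atResidue
    ≡⟨ cong (_+ countFrom (suc w) (top ∸ suc w) atResidue) (countFrom-concat atResidue 1≤u (m≤n⇒m≤1+n u≤w)) ⟩
  countFrom 1 (suc w ∸ 1) atResidue + countFrom (suc w) (top ∸ suc w) atResidue
    ≡⟨ countFrom-concat atResidue (s≤s z≤n) w<top ⟩
  countFrom 1 (top ∸ 1) atResidue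
    ≡⟨ numDiags≡countFrom ν-partition 1≤ℓ k r ⟨
  numDiags k r ν ∎
  where
  open ≡-Reasoning
  open StdKTableau tableau using (β)
  open Step 1≤k tableau 1≤i i≤m
  open Extremes iup idown highest lowest
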